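{- If $s\in\{0,1\}^n$ is primitive and reflexive, then $s$ is $2$-alternating; i.e. $n$ is even and $s = s'\,\iota(s')$ for some $s'\in\{0,1\}^{n/2}$.
   Context: $\iota$ swaps $0$ and $1$ in every position. A binary string is primitive if no nontrivial cyclic rotation of it equals itself. It is reflexive if $\iota(s)$ is a cyclic rotation of $s$. A string of length $n$ is $k$-alternating if it is the concatenation of $k$ strings $u,\iota(u),u,\iota(u),\ldots$, each of length $n/k$. -}

module Defs where

open import Data.Bool using (Bool; not)
open import Data.Nat using (ℕ; zero; suc; _+_; _<_)
open import Data.Vec using (Vec; []; _∷_; _∷ʳ_; map; _++_)
open import Data.Product using (Σ; ∃; _×_; _,_)
open import Data.Empty using (⊥)
open import Relation.Binary.PropositionalEquality using (_≡_; subst)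

ι : ∀ {n} → Vec Bool n → Vec Bool n
ι = map not

rot1 : ∀ {n} → Vec Bool n → Vec Bool n
rot1 [] = []
rot1 (x ∷ xs) = xs ∷ʳ x

rotate : ∀ {n} → ℕ → Vec Bool n → Vec Bool n
rotate zero s = s
rotate (suc k) s = rotate k (rot1 s)

Primitive : ∀ {n} → Vec Bool n → Set
Primitive {n} s = ∀ k → 0 < k → k < n → rotate k s ≡ s → ⊥

Reflexive : ∀ {n} → Vec Bool n → Set
Reflexive s = ∃ λ k → ι s ≡ rotate k s

TwoAlternating : ∀ {n} → Vec Bool n → Set
TwoAlternating {n} s =
  Σ ℕ λ m → Σ (m + m ≡ n) λ eq → Σ (Vec Bool m) λ s' →
    s ≡ subst (Vec Bool) eq (s' ++ ι s')

{-# OPTIONS --safe #-}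
-- Reduce the rotation amount r with ι s = rotate r s modulo n. Then r ≠ 0 since ι has no
-- fixed points, and rotating by r twice gives ι (ι s) = s, so primitivity forces n ∣ r + r,
-- which with 0 < r < n means r + r = n. Writing s = x ++ y with |x| = |y| = r, rotating by r
-- gives y ++ x = ι x ++ ι y, hence y = ι x.
module Submission where

open import Defs
open import Data.Bool using (Bool; not)
open import Data.Bool.Properties using (not-involutive; not-¬)
open import Data.Nat using (ℕ; zero; suc; _+_; _*_; _≤_; _<_; _%_; _/_; NonZero)
open import Data.Nat.Properties
  using (+-identityʳ; +-mono-<; +-monoʳ-≤; m≤m+n; <-≤-trans; <-irrefl; ≤⇒≯; n≢0⇒n>0; _≟_)
open import Data.Nat.DivMod using (m≡m%n+[m/n]*n; m%n<n)
open import Data.Nat.Divisibility using (_∣_; divides; m%n≡0⇒n∣m)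
open import Data.Vec using (Vec; []; _∷_; _∷ʳ_; _++_; toList; splitAt; head)
open import Data.Vec.Properties
  using (toList-injective; cast-is-id; toList-∷ʳ; toList-++; length-toList; map-∷ʳ; map-++;
         map-∘; map-cong; map-id; ++-injectiveˡ)
open import Data.List as List using (List; [_])
open import Data.List.Properties using (++-identityʳ; ++-assoc)
open import Data.Product using (_,_)
open import Data.Empty using (⊥-elim)
open import Relation.Nullary using (yes; no; contradiction)
open import Relation.Binary.PropositionalEquality
  using (_≡_; _≢_; refl; sym; trans; cong; subst; module ≡-Reasoning)
open ≡-Reasoning

-- Rotation is analysed on lists, where xs ++ ys and ys ++ xs have the same type.
rotateᴸ : ℕ → List Bool → List Bool
rotateᴸ zero xs = xs
rotateᴸ (suc k) List.[] = rotateᴸ k List.[]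
rotateᴸ (suc k) (x List.∷ xs) = rotateᴸ k (xs List.++ [ x ])

rotateᴸ-++ : (xs ys : List Bool) → rotateᴸ (List.length xs) (xs List.++ ys) ≡ ys List.++ xs
rotateᴸ-++ List.[] ys = sym (++-identityʳ ys)
rotateᴸ-++ (x List.∷ xs) ys = begin
  rotateᴸ (List.length xs) ((xs List.++ ys) List.++ [ x ])
    ≡⟨ cong (rotateᴸ (List.length xs)) (++-assoc xs ys [ x ]) ⟩
  rotateᴸ (List.length xs) (xs List.++ ys List.++ [ x ])
    ≡⟨ rotateᴸ-++ xs (ys List.++ [ x ]) ⟩
  (ys List.++ [ x ]) List.++ xs
    ≡⟨ ++-assoc ys [ x ] xs ⟩
  ys List.++ x List.∷ xs
    ∎

toList-rotate : ∀ {n} k (s : Vec Bool n) → toList (rotate k s) ≡ rotateᴸ k (toList s)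
toList-rotate zero s = refl
toList-rotate (suc k) [] = toList-rotate k []
toList-rotate (suc k) (x ∷ xs) =
  trans (toList-rotate k (xs ∷ʳ x)) (cong (rotateᴸ k) (toList-∷ʳ x xs))

toList-rotate-++ : ∀ {m n} (xs : Vec Bool m) (ys : Vec Bool n) →
                   toList (rotate m (xs ++ ys)) ≡ toList (ys ++ xs)
toList-rotate-++ {m} xs ys = begin
  toList (rotate m (xs ++ ys))
    ≡⟨ toList-rotate m (xs ++ ys) ⟩
  rotateᴸ m (toList (xs ++ ys))
    ≡⟨ cong (rotateᴸ m) (toList-++ xs ys) ⟩
  rotateᴸ m (toList xs List.++ toList ys)
    ≡⟨ cong (λ k → rotateᴸ k (toList xs List.++ toList ys)) (length-toList xs) ⟨
  rotateᴸ (List.length (toList xs)) (toList xs List.++ toList ys)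
    ≡⟨ rotateᴸ-++ (toList xs) (toList ys) ⟩
  toList ys List.++ toList xs
    ≡⟨ toList-++ ys xs ⟨
  toList (ys ++ xs)
    ∎

toList-injective′ : ∀ {n} (xs ys : Vec Bool n) → toList xs ≡ toList ys → xs ≡ ys
toList-injective′ xs ys eq = trans (sym (cast-is-id refl xs)) (toList-injective refl xs ys eq)

rotate-++ : ∀ {m} (xs ys : Vec Bool m) → rotate m (xs ++ ys) ≡ ys ++ xs
rotate-++ xs ys = toList-injective′ _ _ (toList-rotate-++ xs ys)

rotate-length : ∀ {n} (s : Vec Bool n) → rotate n s ≡ s
rotate-length {n} s = toList-injective′ _ _ (begin
  toList (rotate n s)
    ≡⟨ toList-rotate n s ⟩
  rotateᴸ n (toList s)
    ≡⟨ cong (λ k → rotateᴸ k (toList s)) (length-toList s) ⟨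
  rotateᴸ (List.length (toList s)) (toList s)
    ≡⟨ cong (rotateᴸ (List.length (toList s))) (++-identityʳ (toList s)) ⟨
  rotateᴸ (List.length (toList s)) (toList s List.++ List.[])
    ≡⟨ rotateᴸ-++ (toList s) List.[] ⟩
  toList s
    ∎)

rotate-+ : ∀ {n} a b (s : Vec Bool n) → rotate (a + b) s ≡ rotate b (rotate a s)
rotate-+ zero b s = refl
rotate-+ (suc a) b s = rotate-+ a b (rot1 s)

rotate-*-length : ∀ {n} q (s : Vec Bool n) → rotate (q * n) s ≡ s
rotate-*-length zero s = refl
rotate-*-length {n} (suc q) s = begin
  rotate (n + q * n) s          ≡⟨ rotate-+ n (q * n) s ⟩
  rotate (q * n) (rotate n s)   ≡⟨ cong (rotate (q * n)) (rotate-length s) ⟩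
  rotate (q * n) s              ≡⟨ rotate-*-length q s ⟩
  s                             ∎

rotate-% : ∀ {n} .{{_ : NonZero n}} k (s : Vec Bool n) → rotate (k % n) s ≡ rotate k s
rotate-% {n} k s = sym (begin
  rotate k s                                ≡⟨ cong (λ j → rotate j s) (m≡m%n+[m/n]*n k n) ⟩
  rotate (k % n + k / n * n) s              ≡⟨ rotate-+ (k % n) (k / n * n) s ⟩
  rotate (k / n * n) (rotate (k % n) s)     ≡⟨ rotate-*-length (k / n) _ ⟩
  rotate (k % n) s                          ∎)

ι-rot1 : ∀ {n} (s : Vec Bool n) → rot1 (ι s) ≡ ι (rot1 s)
ι-rot1 [] = refl
ι-rot1 (x ∷ xs) = sym (map-∷ʳ not x xs)

ι-rotate : ∀ {n} k (s : Vec Bool n) → rotate k (ι s) ≡ ι (rotate k s)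
ι-rotate zero s = refl
ι-rotate (suc k) s = trans (cong (rotate k) (ι-rot1 s)) (ι-rotate k (rot1 s))

ι-involutive : ∀ {n} (s : Vec Bool n) → ι (ι s) ≡ s
ι-involutive s = trans (sym (map-∘ not not s)) (trans (map-cong not-involutive s) (map-id s))

ιs≢s : ∀ {n} (s : Vec Bool (suc n)) → ι s ≢ s
ιs≢s (x ∷ xs) eq = not-¬ refl (sym (cong head eq))

rotate≡ι⇒rotate-double≡id : ∀ {n} r (s : Vec Bool n) → rotate r s ≡ ι s → rotate (r + r) s ≡ s
rotate≡ι⇒rotate-double≡id r s eq = begin
  rotate (r + r) s        ≡⟨ rotate-+ r r s ⟩
  rotate r (rotate r s)   ≡⟨ cong (rotate r) eq ⟩
  rotate r (ι s)          ≡⟨ ι-rotate r s ⟩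
  ι (rotate r s)          ≡⟨ cong ι eq ⟩
  ι (ι s)                 ≡⟨ ι-involutive s ⟩
  s                       ∎

Primitive⇒length∣period : ∀ {n} .{{_ : NonZero n}} {s : Vec Bool n} → Primitive s →
                          ∀ p → rotate p s ≡ s → n ∣ p
Primitive⇒length∣period {n} {s} prim p eq with p % n ≟ 0
... | yes p%n≡0 = m%n≡0⇒n∣m p n p%n≡0
... | no p%n≢0 = ⊥-elim (prim (p % n) (n≢0⇒n>0 p%n≢0) (m%n<n p n) (trans (rotate-% p s) eq))

0<r<n∧n∣r+r⇒r+r≡n : ∀ {n r} → 0 < r → r < n → n ∣ r + r → r + r ≡ n
0<r<n∧n∣r+r⇒r+r≡n 0<r r<n (divides zero eq) =
  ⊥-elim (<-irrefl (sym eq) (<-≤-trans 0<r (m≤m+n _ _)))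
0<r<n∧n∣r+r⇒r+r≡n {n} 0<r r<n (divides 1 eq) = trans eq (+-identityʳ n)
0<r<n∧n∣r+r⇒r+r≡n {n} 0<r r<n (divides (suc (suc q)) eq) =
  contradiction (+-mono-< r<n r<n)
    (≤⇒≯ (subst (n + n ≤_) (sym eq) (+-monoʳ-≤ n (m≤m+n n (q * n)))))

rotate-half-ι⇒TwoAlternating : ∀ {n} r (s : Vec Bool n) → r + r ≡ n → rotate r s ≡ ι s →
                               TwoAlternating s
rotate-half-ι⇒TwoAlternating r s refl rot≡ι with splitAt r s
... | xs , ys , refl = r , refl , xs , cong (xs ++_) (++-injectiveˡ ys (ι xs) (begin
  ys ++ xs            ≡⟨ rotate-++ xs ys ⟨
  rotate r (xs ++ ys) ≡⟨ rot≡ι ⟩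
  ι (xs ++ ys)        ≡⟨ map-++ not xs ys ⟩
  ι xs ++ ι ys        ∎))

lemma2p8 : (n : ℕ) (s : Vec Bool n) → Primitive s → Reflexive s → TwoAlternating s
lemma2p8 zero [] _ _ = 0 , refl , [] , refl
lemma2p8 n@(suc _) s prim (k , ι≡rot) = rotate-half-ι⇒TwoAlternating r s r+r≡n rot≡ι
  where
  r : ℕ
  r = k % n
  rot≡ι : rotate r s ≡ ι s
  rot≡ι = trans (rotate-% k s) (sym ι≡rot)
  0<r : 0 < r
  0<r = n≢0⇒n>0 λ r≡0 → ιs≢s s (trans (sym rot≡ι) (cong (λ j → rotate j s) r≡0))
  r+r≡n : r + r ≡ n
  r+r≡n = 0<r<n∧n∣r+r⇒r+r≡n 0<r (m%n<n k n)
            (Primitive⇒length∣period prim (r + r) (rotate≡ι⇒rotate-double≡id r s rot≡ι))
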